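{- For every integer $k\geq 2$ there exist infinitely many graphs $G$ such that $G$ is determined by its connected $k$-sets but not by its connected $(k+1)$-sets; that is, no graph $H\neq G$ on the vertex set of $G$ has the same family of connected $k$-sets as $G$, while some graph $H\neq G$ on the vertex set of $G$ has the same family of connected $(k+1)$-sets as $G$.
   Context: All graphs are finite, simple and connected. For a graph $G=(V,E)$ and $j\geq 2$, the connected $j$-sets are the sets $X\subseteq V$ with $|X|=j$ such that $G[X]$ is connected. Graphs are labelled: equality means equal edge sets. -}

module Defs where

open import Data.Nat using (ℕ; suc; _≤_)
open import Data.Bool using (Bool; true; false)
open import Data.Fin using (Fin)
open import Data.Fin.Subset using (Subset; _∈_; ⊤; ∣_∣)
open import Data.Product using (Σ; ∃-syntax; _×_)
open import Relation.Binary.PropositionalEquality using (_≡_)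
open import Relation.Nullary using (¬_)

record Graph (n : ℕ) : Set where
  field
    adj     : Fin n → Fin n → Bool
    sym     : ∀ u v → adj u v ≡ adj v u
    irrefl  : ∀ u → adj u u ≡ false
open Graph public

SameGraph : {n : ℕ} → Graph n → Graph n → Set
SameGraph G H = ∀ u v → adj G u v ≡ adj H u v

data WalkIn {n : ℕ} (G : Graph n) (X : Subset n) : Fin n → Fin n → Set where
  stay : ∀ {u} → u ∈ X → WalkIn G X u u
  step : ∀ {u w v} → u ∈ X → adj G u w ≡ true → WalkIn G X w v → WalkIn G X u v

InducedConnected : {n : ℕ} → Graph n → Subset n → Set
InducedConnected G X = ∀ u v → u ∈ X → v ∈ X → WalkIn G X u v

Connected : {n : ℕ} → Graph n → Set
Connected G = InducedConnected G ⊤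

ConnectedSet : {n : ℕ} → ℕ → Graph n → Subset n → Set
ConnectedSet j G X = (∣ X ∣ ≡ j) × InducedConnected G X

SameConnectedSets : {n : ℕ} → ℕ → Graph n → Graph n → Set
SameConnectedSets j G H =
  ∀ X → (ConnectedSet j G X → ConnectedSet j H X) × (ConnectedSet j H X → ConnectedSet j G X)

DeterminedBy : {n : ℕ} → ℕ → Graph n → Set
DeterminedBy {n} j G = ∀ (H : Graph n) → Connected H → SameConnectedSets j G H → SameGraph G H

NotDeterminedBy : {n : ℕ} → ℕ → Graph n → Set
NotDeterminedBy {n} j G =
  Σ (Graph n) (λ H → Connected H × ¬ SameGraph G H × SameConnectedSets j G H)

-- Take the lollipop on 0, …, n−1: the path 0 – 1 – ⋯ – (n−1) plus the chord {0, K+1}, so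
-- that 0, …, K+1 is a cycle. Adding the shortcut {0, K} keeps the connected (K+1)-sets: a
-- connected (K+1)-set using the shortcut either contains K+1, which joins 0 and K by a path of
-- the lollipop, or avoids it and is then exactly {0, …, K}.
-- For the K-sets, let H have the same connected K-sets as the lollipop G, and let J be a connected
-- K-set of G. A vertex outside J with no G-neighbour in J has no H-neighbour in J either:
-- otherwise a connected (K−1)-subset of J in H, together with that vertex, would be a connected
-- K-set of H but not of G. And since J is connected in H, a vertex of J that is H-adjacent to no
-- other vertex of J but possibly one is H-adjacent to that one. Applied to windows of K
-- consecutive vertices and to {0} ∪ {K+1, …, 2K−1}, these two facts recover every edge and
-- non-edge of G but the shortcut, which is excluded since it would make {0, …, K−2, K}
-- connected in H.
module Submission where

open import Defs hiding (sym)
open import Data.Bool using (true; false)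
open import Data.Fin using (Fin; zero; suc; toℕ; fromℕ<)
open import Data.Fin.Properties using (toℕ-fromℕ<; toℕ-injective; toℕ<n; any?)
open import Data.Fin.Subset using (Subset; _∈_; _∉_; _⊆_; ⁅_⁆; _∪_; _-_; ∣_∣; inside; outside)
open import Data.Fin.Subset.Properties
  using (_∈?_; ∈⊤; x∈⁅x⁆; x∈⁅y⁆⇒x≡y; ∣⁅x⁆∣≡1; x∈p∪q⁻; x∈p∪q⁺; ∪-identityʳ; p⊆q⇒∣p∣≤∣q∣;
         x∈p⇒∣p-x∣<∣p∣; x∈p∧x≢y⇒x∈p-y)
open import Data.Nat using (ℕ; zero; suc; _+_; _∸_; _⊓_; _≤_; _<_; z≤n; s≤s; z<s; _≤?_; _≟_)
open import Data.Nat.Properties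
open import Data.Product using (Σ; ∃-syntax; _×_; _,_; proj₁; proj₂)
open import Data.Sum using (_⊎_; inj₁; inj₂; [_,_]; swap)
open import Data.Vec using ([]; _∷_; here; there)
open import Function using (_∘_; mk⇔)
open import Level using (0ℓ)
open import Relation.Binary using (Rel; Decidable; Symmetric; Irreflexive; tri<; tri≈; tri>)
import Relation.Binary.Construct.Union as Union
open import Relation.Binary.PropositionalEquality using (_≡_; _≢_; refl; sym; trans; cong; subst)
open import Relation.Nullary using (¬_; yes; no; does; contradiction)
open import Relation.Nullary.Decidable using (dec-true; dec-false; does-⇔; ¬?; _⊎-dec_; _×-dec_)

private variable
  n : ℕ
  G H : Graph n
  X Y : Subset n
  u v w x : Fin n

adj-sym : (G : Graph n) → adj G u v ≡ true → adj G v u ≡ true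
adj-sym G e = trans (Graph.sym G _ _) e

adj-false-sym : (G : Graph n) → adj G u v ≡ false → adj G v u ≡ false
adj-false-sym G e = trans (Graph.sym G _ _) e

walk-source : WalkIn G X u v → u ∈ X
walk-source (stay u∈X)     = u∈X
walk-source (step u∈X _ _) = u∈X

walk-++ : WalkIn G X u v → WalkIn G X v w → WalkIn G X u w
walk-++ (stay _)       q = q
walk-++ (step u∈X e p) q = step u∈X e (walk-++ p q)

walk-reverse : WalkIn G X u v → WalkIn G X v u
walk-reverse         (stay u∈X)     = stay u∈X
walk-reverse {G = G} (step u∈X e p) =
  walk-++ (walk-reverse p) (step (walk-source p) (adj-sym G e) (stay u∈X))

walk-⊆ : X ⊆ Y → WalkIn G X u v → WalkIn G Y u v
walk-⊆ X⊆Y (stay u∈X)     = stay (X⊆Y u∈X)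
walk-⊆ X⊆Y (step u∈X e p) = step (X⊆Y u∈X) e (walk-⊆ X⊆Y p)

walk-map : (∀ {u w} → u ∈ X → w ∈ X → adj G u w ≡ true → WalkIn H X u w) →
           WalkIn G X u v → WalkIn H X u v
walk-map f (stay u∈X)     = stay u∈X
walk-map f (step u∈X e p) = walk-++ (f u∈X (walk-source p) e) (walk-map f p)

walk-invariant : (P : Fin n → Set) → (∀ {u w} → w ∈ X → adj G u w ≡ true → P u → P w) →
                 WalkIn G X u v → P u → P v
walk-invariant P closed (stay _)     Pu = Pu
walk-invariant P closed (step _ e p) Pu = walk-invariant P closed p (closed (walk-source p) e Pu)

walk-exit : WalkIn G Y u v → u ∈ X → v ∉ X →
            ∃[ w ] (w ∈ Y × w ∉ X × ∃[ x ] (x ∈ X × adj G x w ≡ true))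
walk-exit (stay _) u∈X v∉X = contradiction u∈X v∉X
walk-exit {X = X} (step {u = u} {w = w} _ e p) u∈X v∉X with w ∈? X
... | yes w∈X = walk-exit p w∈X v∉X
... | no w∉X  = w , walk-source p , w∉X , u , u∈X , e

connected-via : {hub : Fin n} → (∀ {u} → u ∈ X → WalkIn G X u hub) → InducedConnected G X
connected-via to-hub u v u∈X v∈X = walk-++ (to-hub u∈X) (walk-reverse (to-hub v∈X))

neighbour-in : InducedConnected G X → u ∈ X → v ∈ X → u ≢ v → ∃[ w ] (w ∈ X × adj G u w ≡ true)
neighbour-in {u = u} {v} conn u∈X v∈X u≢v with conn u v u∈X v∈X
... | stay _             = contradiction refl u≢v
... | step {w = w} _ e p = w , walk-source p , e

sole-neighbour : InducedConnected H X → u ∈ X → v ∈ X → u ≢ v →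
                 (∀ {w} → w ∈ X → w ≢ u → w ≢ v → adj H u w ≡ false) → adj H u v ≡ true
sole-neighbour {H = H} {u = u} {v = v} conn u∈X v∈X u≢v others with neighbour-in conn u∈X v∈X u≢v
... | w , w∈X , e with w Data.Fin.≟ v | w Data.Fin.≟ u
... | yes refl | _        = e
... | no _     | yes refl = contradiction (trans (sym e) (Graph.irrefl H u)) λ ()
... | no w≢v   | no w≢u   = contradiction (trans (sym e) (others w∈X w≢u w≢v)) λ ()

⁅x⁆-connected : (x : Fin n) → InducedConnected G ⁅ x ⁆
⁅x⁆-connected x u v u∈ v∈ with x∈⁅y⁆⇒x≡y x u∈ | x∈⁅y⁆⇒x≡y x v∈
... | refl | refl = stay u∈

∪⁅⁆-connected : InducedConnected G X → u ∈ X → adj G u w ≡ true → InducedConnected G (X ∪ ⁅ w ⁆)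
∪⁅⁆-connected {G = G} {X = X} {u = u} {w} conn u∈X e = connected-via to-u
  where
  X⊆X∪w : X ⊆ X ∪ ⁅ w ⁆
  X⊆X∪w p = x∈p∪q⁺ (inj₁ p)
  to-u : ∀ {x} → x ∈ X ∪ ⁅ w ⁆ → WalkIn G (X ∪ ⁅ w ⁆) x u
  to-u {x} x∈ with x∈p∪q⁻ X ⁅ w ⁆ x∈
  ... | inj₁ x∈X = walk-⊆ X⊆X∪w (conn x u x∈X u∈X)
  ... | inj₂ x∈w with x∈⁅y⁆⇒x≡y w x∈w
  ... | refl = step x∈ (adj-sym G e) (stay (X⊆X∪w u∈X))

∣p∪⁅x⁆∣≡1+∣p∣ : (p : Subset n) → x ∉ p → ∣ p ∪ ⁅ x ⁆ ∣ ≡ suc ∣ p ∣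
∣p∪⁅x⁆∣≡1+∣p∣ {x = zero}  (inside  ∷ p) x∉p = contradiction here x∉p
∣p∪⁅x⁆∣≡1+∣p∣ {x = zero}  (outside ∷ p) _   = cong (λ q → suc ∣ q ∣) (∪-identityʳ p)
∣p∪⁅x⁆∣≡1+∣p∣ {x = suc x} (inside  ∷ p) x∉p = cong suc (∣p∪⁅x⁆∣≡1+∣p∣ p (x∉p ∘ there))
∣p∪⁅x⁆∣≡1+∣p∣ {x = suc x} (outside ∷ p) x∉p = ∣p∪⁅x⁆∣≡1+∣p∣ p (x∉p ∘ there)

∣p∣<∣q∣⇒∃∈q∖p : (p q : Subset n) → ∣ p ∣ < ∣ q ∣ → ∃[ x ] (x ∈ q × x ∉ p)
∣p∣<∣q∣⇒∃∈q∖p p q ∣p∣<∣q∣ with any? (λ x → (x ∈? q) ×-dec ¬? (x ∈? p))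
... | yes found = found
... | no none   = contradiction (p⊆q⇒∣p∣≤∣q∣ q⊆p) (<⇒≱ ∣p∣<∣q∣)
  where
  q⊆p : q ⊆ p
  q⊆p {x} x∈q with x ∈? p
  ... | yes x∈p = x∈p
  ... | no x∉p  = contradiction (x , x∈q , x∉p) none

p⊆q∧∣q∣≤∣p∣⇒q⊆p : (p q : Subset n) → p ⊆ q → ∣ q ∣ ≤ ∣ p ∣ → q ⊆ p
p⊆q∧∣q∣≤∣p∣⇒q⊆p p q p⊆q ∣q∣≤∣p∣ {x} x∈q with x ∈? p
... | yes x∈p = x∈p
... | no x∉p  =
  contradiction (≤-<-trans ∣q∣≤∣p∣ (≤-<-trans (p⊆q⇒∣p∣≤∣q∣ p⊆q-x) (x∈p⇒∣p-x∣<∣p∣ x∈q))) (<-irrefl refl)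
  where
  p⊆q-x : p ⊆ q - x
  p⊆q-x y∈p = x∈p∧x≢y⇒x∈p-y (p⊆q y∈p) λ { refl → x∉p y∈p }

connected-subset : InducedConnected G Y → x ∈ Y → (s : ℕ) → suc s ≤ ∣ Y ∣ →
  Σ (Subset _) λ X → X ⊆ Y × InducedConnected G X × x ∈ X × ∣ X ∣ ≡ suc s
connected-subset {x = x} _ x∈Y zero _ = ⁅ x ⁆ , ⁅x⁆⊆Y , ⁅x⁆-connected x , x∈⁅x⁆ x , ∣⁅x⁆∣≡1 x
  where
  ⁅x⁆⊆Y : ⁅ x ⁆ ⊆ _
  ⁅x⁆⊆Y y∈ with x∈⁅y⁆⇒x≡y x y∈
  ... | refl = x∈Y
connected-subset {Y = Y} {x = x} conn x∈Y (suc s) s<∣Y∣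
  with connected-subset conn x∈Y s (<⇒≤ s<∣Y∣)
... | X , X⊆Y , X-conn , x∈X , ∣X∣≡ with ∣p∣<∣q∣⇒∃∈q∖p X Y (subst (_< ∣ Y ∣) (sym ∣X∣≡) s<∣Y∣)
... | v , v∈Y , v∉X with walk-exit (conn x v x∈Y v∈Y) x∈X v∉X
... | w , w∈Y , w∉X , y , y∈X , e =
  X ∪ ⁅ w ⁆ , X∪w⊆Y , ∪⁅⁆-connected X-conn y∈X e , x∈p∪q⁺ (inj₁ x∈X) ,
  trans (∣p∪⁅x⁆∣≡1+∣p∣ X w∉X) (cong suc ∣X∣≡)
  where
  X∪w⊆Y : X ∪ ⁅ w ⁆ ⊆ Y
  X∪w⊆Y z∈ with x∈p∪q⁻ X ⁅ w ⁆ z∈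
  ... | inj₁ z∈X = X⊆Y z∈X
  ... | inj₂ z∈w with x∈⁅y⁆⇒x≡y w z∈w
  ... | refl = w∈Y

nonadjacent-preserved : ∀ {j} → SameConnectedSets (suc (suc j)) G H →
  (J : Subset n) → ConnectedSet (suc (suc j)) G J → x ∈ J → u ∉ J →
  (∀ {w} → w ∈ J → adj G u w ≡ false) → adj H u x ≡ false
nonadjacent-preserved {G = G} {H = H} {x = x} {u = i} {j} same J J-conn x∈J i∉J isolated
  with adj H i x in e
... | false = refl
... | true with connected-subset (proj₂ (proj₁ (same J) J-conn)) x∈J j
                                 (subst (suc j ≤_) (sym (proj₁ J-conn)) (n≤1+n (suc j)))
... | A , A⊆J , A-conn , x∈A , ∣A∣≡ with neighbour-in (proj₂ A∪i-conn) i∈A∪i x∈A∪i (i∉A ∘ x∈A⇒)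
  where
  i∉A : i ∉ A
  i∉A = i∉J ∘ A⊆J
  x∈A⇒ : i ≡ x → i ∈ A
  x∈A⇒ refl = x∈A
  A∪i-conn : ConnectedSet (suc (suc j)) G (A ∪ ⁅ i ⁆)
  A∪i-conn = proj₂ (same (A ∪ ⁅ i ⁆))
    (trans (∣p∪⁅x⁆∣≡1+∣p∣ A i∉A) (cong suc ∣A∣≡) , ∪⁅⁆-connected A-conn x∈A (adj-sym H e))
  i∈A∪i : i ∈ A ∪ ⁅ i ⁆
  i∈A∪i = x∈p∪q⁺ (inj₂ (x∈⁅x⁆ i))
  x∈A∪i : x ∈ A ∪ ⁅ i ⁆
  x∈A∪i = x∈p∪q⁺ (inj₁ x∈A)
... | w , w∈ , e′ with x∈p∪q⁻ A ⁅ i ⁆ w∈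
...   | inj₁ w∈A = contradiction (trans (sym e′) (isolated (A⊆J w∈A))) λ ()
...   | inj₂ w∈i with x∈⁅y⁆⇒x≡y i w∈i
...     | refl = contradiction (trans (sym e′) (Graph.irrefl G i)) λ ()

ContainsPath : Graph n → Set
ContainsPath G = ∀ {v w} → toℕ w ≡ suc (toℕ v) → adj G v w ≡ true

walk-up : ∀ {n} {G : Graph n} {X : Subset n} → ContainsPath G →
  ∀ d {u v} → d + toℕ u ≡ toℕ v → (∀ {w} → toℕ u ≤ toℕ w → toℕ w ≤ toℕ v → w ∈ X) → WalkIn G X u v
walk-up _ zero {u} e range with toℕ-injective e
... | refl = stay (range ≤-refl ≤-refl)
walk-up {n = n} {X = X} path (suc d) {u} {v} e range =
  step (range ≤-refl (<⇒≤ u<v)) (path (toℕ-fromℕ< u+1<n)) (walk-up path d e′ range′)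
  where
  u<v : toℕ u < toℕ v
  u<v = subst (toℕ u <_) e (m<n+m (toℕ u) z<s)
  u+1<n : suc (toℕ u) < n
  u+1<n = ≤-<-trans u<v (toℕ<n v)
  e′ : d + toℕ (fromℕ< u+1<n) ≡ toℕ v
  e′ = trans (cong (d +_) (toℕ-fromℕ< u+1<n)) (trans (+-suc d (toℕ u)) e)
  range′ : ∀ {w} → toℕ (fromℕ< u+1<n) ≤ toℕ w → toℕ w ≤ toℕ v → w ∈ X
  range′ w≥ = range (≤-trans (n≤1+n (toℕ u)) (subst (_≤ _) (toℕ-fromℕ< u+1<n) w≥))

walk-along : ContainsPath G →
  toℕ u ≤ toℕ v → (∀ {w} → toℕ u ≤ toℕ w → toℕ w ≤ toℕ v → w ∈ X) → WalkIn G X u v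
walk-along {u = u} {v = v} path u≤v = walk-up path (toℕ v ∸ toℕ u) (m∸n+n≡m u≤v)

interval : (c m n : ℕ) → Subset n
interval _       _       zero    = []
interval zero    zero    (suc n) = outside ∷ interval zero zero n
interval zero    (suc m) (suc n) = inside  ∷ interval zero m n
interval (suc c) m       (suc n) = outside ∷ interval c m n

∈-interval⁻ : ∀ c m {n} {i : Fin n} → i ∈ interval c m n → c ≤ toℕ i × toℕ i < c + m
∈-interval⁻ zero    zero    {i = suc i} (there p) = contradiction (proj₂ (∈-interval⁻ 0 0 p)) λ ()
∈-interval⁻ zero    (suc m) {i = zero}  here      = z≤n , z<s
∈-interval⁻ zero    (suc m) {i = suc i} (there p) = z≤n , s≤s (proj₂ (∈-interval⁻ 0 m p))
∈-interval⁻ (suc c) m       {i = suc i} (there p) with ∈-interval⁻ c m p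
... | c≤i , i<c+m = s≤s c≤i , s≤s i<c+m

∈-interval⁺ : ∀ c m {n} {i : Fin n} → c ≤ toℕ i → toℕ i < c + m → i ∈ interval c m n
∈-interval⁺ zero    (suc m) {i = zero}  _         _           = here
∈-interval⁺ zero    (suc m) {i = suc i} _         (s≤s i<m)   = there (∈-interval⁺ 0 m z≤n i<m)
∈-interval⁺ (suc c) m       {i = suc i} (s≤s c≤i) (s≤s i<c+m) = there (∈-interval⁺ c m c≤i i<c+m)

∣interval∣ : ∀ c m n → c + m ≤ n → ∣ interval c m n ∣ ≡ m
∣interval∣ zero    zero    zero    _        = refl
∣interval∣ zero    zero    (suc n) _        = ∣interval∣ 0 0 n z≤n
∣interval∣ zero    (suc m) (suc n) (s≤s le) = cong suc (∣interval∣ 0 m n le)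
∣interval∣ (suc c) m       (suc n) (s≤s le) = ∣interval∣ c m n le

interval-walk : ContainsPath G → ∀ c m → x ∈ interval c m n → w ∈ interval c m n → toℕ x ≤ toℕ w →
                WalkIn G (interval c m n) x w
interval-walk path c m x∈I w∈I x≤w = walk-along path x≤w λ x≤z z≤w →
  ∈-interval⁺ c m (≤-trans (proj₁ (∈-interval⁻ c m x∈I)) x≤z)
                  (≤-<-trans z≤w (proj₂ (∈-interval⁻ c m w∈I)))

interval-connected : ContainsPath G → ∀ c m → InducedConnected G (interval c m n)
interval-connected path c m u v u∈I v∈I with ≤-total (toℕ u) (toℕ v)
... | inj₁ u≤v = interval-walk path c m u∈I v∈I u≤v
... | inj₂ v≤u = walk-reverse (interval-walk path c m v∈I u∈I v≤u)

m≢n∧m≢1+n⇒m<n⊎1+n<m : ∀ {m n} → m ≢ n → m ≢ suc n → m < n ⊎ suc n < m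
m≢n∧m≢1+n⇒m<n⊎1+n<m {m} {n} m≢n m≢1+n with <-cmp m n
... | tri< m<n _ _ = inj₁ m<n
... | tri≈ _ m≡n _ = contradiction m≡n m≢n
... | tri> _ _ n<m = inj₂ (≤∧≢⇒< n<m (m≢1+n ∘ sym))

module FromRelation {R : Rel ℕ 0ℓ} (R? : Decidable R) (R-sym : Symmetric R)
                    (R-irrefl : Irreflexive _≡_ R) (n : ℕ) where

  graph : Graph n
  graph = record
    { adj    = λ u v → does (R? (toℕ u) (toℕ v))
    ; sym    = λ u v → does-⇔ (mk⇔ R-sym R-sym) (R? (toℕ u) (toℕ v)) (R? (toℕ v) (toℕ u))
    ; irrefl = λ u → dec-false (R? (toℕ u) (toℕ u)) (R-irrefl refl)
    }

  adj⁺ : ∀ {u v} → R (toℕ u) (toℕ v) → adj graph u v ≡ true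
  adj⁺ {u} {v} = dec-true (R? (toℕ u) (toℕ v))

  adj⁻ : ∀ {u v} → adj graph u v ≡ true → R (toℕ u) (toℕ v)
  adj⁻ {u} {v} e with R? (toℕ u) (toℕ v)
  ... | yes r = r
  ... | no _  = contradiction e λ ()

  adj-false : ∀ {u v} → ¬ R (toℕ u) (toℕ v) → adj graph u v ≡ false
  adj-false {u} {v} = dec-false (R? (toℕ u) (toℕ v))

Consecutive : Rel ℕ 0ℓ
Consecutive a b = b ≡ suc a ⊎ a ≡ suc b

consecutive? : Decidable Consecutive
consecutive? a b = (b ≟ suc a) ⊎-dec (a ≟ suc b)

consecutive-sym : Symmetric Consecutive
consecutive-sym = swap

consecutive-irrefl : Irreflexive _≡_ Consecutive
consecutive-irrefl refl = [ 1+n≢n ∘ sym , 1+n≢n ∘ sym ]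

Chord : ℕ → Rel ℕ 0ℓ
Chord c a b = a ≡ 0 × b ≡ c ⊎ a ≡ c × b ≡ 0

chord? : ∀ c → Decidable (Chord c)
chord? c a b = ((a ≟ 0) ×-dec (b ≟ c)) ⊎-dec ((a ≟ c) ×-dec (b ≟ 0))

chord-sym : ∀ {c} → Symmetric (Chord c)
chord-sym (inj₁ (a≡0 , b≡c)) = inj₂ (b≡c , a≡0)
chord-sym (inj₂ (a≡c , b≡0)) = inj₁ (b≡0 , a≡c)

chord-irrefl : ∀ {c} → Irreflexive _≡_ (Chord (suc c))
chord-irrefl refl (inj₁ (refl , ()))
chord-irrefl refl (inj₂ (refl , ()))

module Lollipop (k m : ℕ) where

  K : ℕ
  K = suc (suc k)

  order : ℕ
  order = 2 + K + K + m

  2K+2≤order : 2 + K + K ≤ order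
  2K+2≤order = m≤m+n (2 + K + K) m

  K≤order : K ≤ order
  K≤order = ≤-trans (m≤n+m K (2 + K)) 2K+2≤order

  K+1<order : suc K < order
  K+1<order = ≤-trans (m≤m+n (2 + K) K) 2K+2≤order

  Edge : Rel ℕ 0ℓ
  Edge = Consecutive Union.∪ Chord (suc K)

  edge? : Decidable Edge
  edge? = Union.decidable consecutive? (chord? (suc K))

  edge-sym : Symmetric Edge
  edge-sym = Union.symmetric {L = Consecutive} {R = Chord (suc K)} consecutive-sym chord-sym

  edge-irrefl : Irreflexive _≡_ Edge
  edge-irrefl = Union.irreflexive _≡_ Consecutive (Chord (suc K)) consecutive-irrefl chord-irrefl

  ¬edge-far : ∀ {a b} → suc a < b → (a ≡ 0 → b ≢ suc K) → ¬ Edge a b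
  ¬edge-far a+1<b _         (inj₁ (inj₁ refl))        = <-irrefl refl a+1<b
  ¬edge-far a+1<b _         (inj₁ (inj₂ refl))        = <⇒≱ a+1<b (≤-trans (n≤1+n _) (n≤1+n _))
  ¬edge-far _     not-chord (inj₂ (inj₁ (a≡0 , b≡c))) = not-chord a≡0 b≡c
  ¬edge-far ()    _         (inj₂ (inj₂ (_ , refl)))

  ¬edge∧<⇒1+< : ∀ {a b} → a < b → ¬ Edge a b → suc a < b
  ¬edge∧<⇒1+< a<b ¬edge = ≤∧≢⇒< a<b λ e → ¬edge (inj₁ (inj₁ (sym e)))

  module L = FromRelation edge? edge-sym edge-irrefl order

  lollipop : Graph order
  lollipop = L.graph

  lollipop-path : ContainsPath lollipop
  lollipop-path e = L.adj⁺ (inj₁ (inj₁ e))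

  lollipop-connected : Connected lollipop
  lollipop-connected u v _ _ =
    walk-⊆ (λ _ → ∈⊤) (interval-connected lollipop-path 0 order u v (everything u) (everything v))
    where
    everything : ∀ w → w ∈ interval 0 order order
    everything w = ∈-interval⁺ 0 order z≤n (toℕ<n w)

  junction : Fin order
  junction = fromℕ< K+1<order

  window : ℕ → Subset order
  window c = interval c K order

  window-connectedSet : ∀ c → c + K ≤ order → ConnectedSet K lollipop (window c)
  window-connectedSet c fits = ∣interval∣ c K order fits , interval-connected lollipop-path c K

  -- The window starting at b, moved left just enough to fit into the vertex set.
  windowFrom : ℕ → ℕ
  windowFrom b = b ⊓ (order ∸ K)

  windowFrom-fits : ∀ b → windowFrom b + K ≤ order
  windowFrom-fits b = ≤-trans (+-monoˡ-≤ K (m⊓n≤n b (order ∸ K))) (≤-reflexive (m∸n+n≡m K≤order))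

  ∈-windowFrom : ∀ {x} → x ∈ window (windowFrom (toℕ x))
  ∈-windowFrom {x} = ∈-interval⁺ _ K (m⊓n≤m (toℕ x) (order ∸ K)) x<start+K
    where
    x<start+K : toℕ x < windowFrom (toℕ x) + K
    x<start+K with toℕ x ≤? order ∸ K
    ... | yes x≤ = subst (λ c → toℕ x < c + K) (sym (m≤n⇒m⊓n≡m x≤)) (m<m+n (toℕ x) z<s)
    ... | no x≰  = subst (λ c → toℕ x < c + K) (sym (m≥n⇒m⊓n≡n (<⇒≤ (≰⇒> x≰))))
                     (subst (toℕ x <_) (sym (m∸n+n≡m K≤order)) (toℕ<n x))

  windowFrom-maximal : ∀ {t b} → t ≤ b → t + K ≤ order → t ≤ windowFrom b
  windowFrom-maximal t≤b fits = ⊓-glb t≤b (m+n≤o⇒m≤o∸n _ fits)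

  windowTo : ℕ → ℕ
  windowTo b = suc b ∸ K

  module _ {b} (K≤b+1 : K ≤ suc b) where

    windowTo+K : windowTo b + K ≡ suc b
    windowTo+K = m∸n+n≡m K≤b+1

    windowTo-fits : b < order → windowTo b + K ≤ order
    windowTo-fits b<order = subst (_≤ order) (sym windowTo+K) b<order

    ∈-windowTo⁺ : ∀ {x} → b < toℕ x + K → toℕ x ≤ b → x ∈ window (windowTo b)
    ∈-windowTo⁺ {x} b<x+K x≤b =
      ∈-interval⁺ _ K (+-cancelʳ-≤ K _ _ (subst (_≤ toℕ x + K) (sym windowTo+K) b<x+K))
                      (subst (toℕ x <_) (sym windowTo+K) (s≤s x≤b))

    ∈-windowTo⁻ : ∀ {x} → x ∈ window (windowTo b) → toℕ x ≤ b
    ∈-windowTo⁻ {x} x∈ = ≤-pred (subst (toℕ x <_) windowTo+K (proj₂ (∈-interval⁻ _ K x∈)))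

  chordSet : Subset order
  chordSet = interval (suc K) (suc k) order ∪ ⁅ zero ⁆

  zero∈chordSet : zero ∈ chordSet
  zero∈chordSet = x∈p∪q⁺ {p = interval (suc K) (suc k) order} (inj₂ (x∈⁅x⁆ zero))

  chordSet-connectedSet : ConnectedSet K lollipop chordSet
  chordSet-connectedSet =
    trans (∣p∪⁅x⁆∣≡1+∣p∣ _ zero∉I) (cong suc (∣interval∣ (suc K) (suc k) order fits)) ,
    ∪⁅⁆-connected {w = zero} (interval-connected lollipop-path (suc K) (suc k)) junction∈I (L.adj⁺ chord)
    where
    zero∉I : zero ∉ interval (suc K) (suc k) order
    zero∉I z∈ with ∈-interval⁻ (suc K) (suc k) z∈
    ... | () , _
    fits : suc K + suc k ≤ order
    fits = ≤-trans (s≤s (+-monoʳ-≤ K (n≤1+n (suc k)))) (≤-trans (n≤1+n _) 2K+2≤order)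
    junction∈I : junction ∈ interval (suc K) (suc k) order
    junction∈I = ∈-interval⁺ (suc K) (suc k) (≤-reflexive (sym (toℕ-fromℕ< K+1<order)))
                   (subst (_< suc K + suc k) (sym (toℕ-fromℕ< K+1<order)) (m<m+n (suc K) z<s))
    chord : Edge (toℕ junction) 0
    chord = inj₂ (inj₂ (toℕ-fromℕ< K+1<order , refl))

  module Determined (H : Graph order) (same : SameConnectedSets K lollipop H) where

    connected-in-H : ∀ {S} → ConnectedSet K lollipop S → InducedConnected H S
    connected-in-H {S} S-conn = proj₂ (proj₁ (same S) S-conn)

    nonadjacent : ∀ J → ConnectedSet K lollipop J → ∀ {u x} → x ∈ J → u ∉ J →
                  (∀ {w} → w ∈ J → ¬ Edge (toℕ u) (toℕ w)) → adj H u x ≡ false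
    nonadjacent J J-conn x∈J u∉J isolated =
      nonadjacent-preserved same J J-conn x∈J u∉J (L.adj-false ∘ isolated)

    nonadjacent-near-chord : ∀ {u v} → toℕ u ≡ 0 → 1 < toℕ v → toℕ v < K → adj H u v ≡ false
    nonadjacent-near-chord {u} {v} u≡0 1<v v<K with toℕ-injective {i = u} {j = zero} u≡0
    ... | refl = adj-false-sym H (nonadjacent chordSet chordSet-connectedSet zero∈chordSet v∉ isolated)
      where
      v∉ : v ∉ chordSet
      v∉ v∈ with x∈p∪q⁻ _ _ v∈
      ... | inj₁ v∈I = <⇒≱ v<K (≤-trans (n≤1+n K) (proj₁ (∈-interval⁻ (suc K) (suc k) v∈I)))
      ... | inj₂ v∈0 with x∈⁅y⁆⇒x≡y zero v∈0
      ... | refl = contradiction 1<v λ ()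
      isolated : ∀ {w} → w ∈ chordSet → ¬ Edge (toℕ v) (toℕ w)
      isolated w∈ with x∈p∪q⁻ _ _ w∈
      ... | inj₁ w∈I = ¬edge-far (≤-trans (s≤s v<K) (proj₁ (∈-interval⁻ (suc K) (suc k) w∈I)))
                                λ v≡0 → contradiction (subst (1 <_) v≡0 1<v) λ ()
      ... | inj₂ w∈0 with x∈⁅y⁆⇒x≡y zero w∈0
      ... | refl = ¬edge-far 1<v (λ _ v≡K+1 → <⇒≱ v<K (subst (K ≤_) (sym v≡K+1) (n≤1+n K))) ∘ edge-sym

    nonadjacent-right : ∀ {u v} → suc (suc (toℕ u)) + K ≤ order → suc (toℕ u) < toℕ v →
                        (toℕ u ≡ 0 → suc K < toℕ v) → adj H u v ≡ false
    nonadjacent-right {u} {v} room u+1<v avoids-chord =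
      nonadjacent (window c) (window-connectedSet c (windowFrom-fits (toℕ v))) ∈-windowFrom u∉ isolated
      where
      c : ℕ
      c = windowFrom (toℕ v)
      u+2≤c : suc (suc (toℕ u)) ≤ c
      u+2≤c = windowFrom-maximal u+1<v room
      u∉ : u ∉ window c
      u∉ u∈ = <⇒≱ (≤-trans (n≤1+n _) u+2≤c) (proj₁ (∈-interval⁻ c K u∈))
      isolated : ∀ {w} → w ∈ window c → ¬ Edge (toℕ u) (toℕ w)
      isolated w∈ = ¬edge-far (≤-trans u+2≤c c≤w) λ u≡0 w≡K+1 →
        <⇒≱ (≤-trans (windowFrom-maximal (avoids-chord u≡0) 2K+2≤order) c≤w) (≤-reflexive w≡K+1)
        where
        c≤w : c ≤ _
        c≤w = proj₁ (∈-interval⁻ c K w∈)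

    nonadjacent-left : ∀ {u v} → order < suc (suc (toℕ u)) + K → suc (toℕ u) < toℕ v →
                       adj H u v ≡ false
    nonadjacent-left {u} {v} no-room u+1<v = adj-false-sym H
      (nonadjacent (window (windowTo a)) (window-connectedSet _ (windowTo-fits K≤a+1 (toℕ<n u)))
                   (∈-windowTo⁺ K≤a+1 (m<m+n a z<s) ≤-refl) v∉ isolated)
      where
      a : ℕ
      a = toℕ u
      K+1≤u : suc K ≤ a
      K+1≤u = ≤-pred (+-cancelʳ-≤ K (suc (suc K)) (suc a) (≤-pred (≤-trans (s≤s 2K+2≤order) no-room)))
      K≤a+1 : K ≤ suc a
      K≤a+1 = ≤-trans (n≤1+n K) (≤-trans K+1≤u (n≤1+n a))
      v∉ : v ∉ window (windowTo a)
      v∉ v∈ = <⇒≱ u+1<v (≤-trans (∈-windowTo⁻ K≤a+1 v∈) (n≤1+n a))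
      isolated : ∀ {w} → w ∈ window (windowTo a) → ¬ Edge (toℕ v) (toℕ w)
      isolated w∈ = ¬edge-far (≤-<-trans (s≤s (∈-windowTo⁻ K≤a+1 w∈)) u+1<v)
        (λ _ v≡K+1 → <⇒≱ (≤-<-trans K+1≤u (≤-trans (n≤1+n _) u+1<v)) (≤-reflexive v≡K+1)) ∘ edge-sym

    nonadjacent-far : ∀ {u v} → suc (toℕ u) < toℕ v → (toℕ u ≡ 0 → toℕ v < K ⊎ suc K < toℕ v) →
                      adj H u v ≡ false
    nonadjacent-far {u} {v} u+1<v avoids-chord with suc (suc (toℕ u)) + K ≤? order
    ... | no no-room = nonadjacent-left (≰⇒> no-room) u+1<v
    ... | yes room with toℕ u ≟ 0
    ...   | no u≢0 = nonadjacent-right room u+1<v (λ u≡0 → contradiction u≡0 u≢0)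
    ...   | yes u≡0 with avoids-chord u≡0
    ...     | inj₁ v<K   = nonadjacent-near-chord u≡0 (subst (λ a → suc a < toℕ v) u≡0 u+1<v) v<K
    ...     | inj₂ K+1<v = nonadjacent-right room u+1<v (λ _ → K+1<v)

    H-path : ContainsPath H
    H-path {u} {v} v≡u+1 with toℕ u + K ≤? order
    ... | yes fits = sole-neighbour (connected-in-H (window-connectedSet a fits)) u∈ v∈ u≢v others
      where
      a : ℕ
      a = toℕ u
      u∈ : u ∈ window a
      u∈ = ∈-interval⁺ a K ≤-refl (m<m+n a z<s)
      v∈ : v ∈ window a
      v∈ = ∈-interval⁺ a K (subst (a ≤_) (sym v≡u+1) (n≤1+n a))
             (subst (_< a + K) (trans (+-comm a 1) (sym v≡u+1)) (+-monoʳ-< a (s≤s (s≤s z≤n))))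
      u≢v : u ≢ v
      u≢v refl = 1+n≢n (sym v≡u+1)
      others : ∀ {w} → w ∈ window a → w ≢ u → w ≢ v → adj H u w ≡ false
      others {w} w∈ w≢u w≢v =
        nonadjacent-far a+1<w (λ a≡0 → inj₁ (subst (λ c → toℕ w < c + K) a≡0 (proj₂ (∈-interval⁻ a K w∈))))
        where
        a+1<w : suc a < toℕ w
        a+1<w = ≤∧≢⇒< (≤∧≢⇒< (proj₁ (∈-interval⁻ a K w∈)) (w≢u ∘ toℕ-injective ∘ sym))
                      (λ e → w≢v (toℕ-injective (trans (sym e) (sym v≡u+1))))
    ... | no no-fit =
      adj-sym H (sole-neighbour (connected-in-H (window-connectedSet _ (windowTo-fits K≤b+1 (toℕ<n v))))
                                v∈ u∈ (u≢v ∘ sym) others)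
      where
      a b : ℕ
      a = toℕ u
      b = toℕ v
      K+3≤a : 3 + K ≤ a
      K+3≤a = +-cancelʳ-≤ K (3 + K) a (≤-trans (s≤s 2K+2≤order) (≰⇒> no-fit))
      K+1<b : suc K < b
      K+1<b = subst (suc K <_) (sym v≡u+1) (≤-trans (n≤1+n _) (≤-trans (n≤1+n _) (s≤s K+3≤a)))
      K≤b+1 : K ≤ suc b
      K≤b+1 = ≤-trans (m≤n+m K 2) (≤-trans K+1<b (n≤1+n b))
      v∈ : v ∈ window (windowTo b)
      v∈ = ∈-windowTo⁺ K≤b+1 (m<m+n b z<s) ≤-refl
      u∈ : u ∈ window (windowTo b)
      u∈ = ∈-windowTo⁺ K≤b+1
             (subst (_< a + K) (trans (+-comm a 1) (sym v≡u+1)) (+-monoʳ-< a (s≤s (s≤s z≤n))))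
             (subst (a ≤_) (sym v≡u+1) (n≤1+n a))
      u≢v : u ≢ v
      u≢v refl = 1+n≢n (sym v≡u+1)
      others : ∀ {w} → w ∈ window (windowTo b) → w ≢ v → w ≢ u → adj H v w ≡ false
      others {w} w∈ w≢v w≢u = adj-false-sym H (nonadjacent-far w+1<b (λ _ → inj₂ K+1<b))
        where
        w<b : toℕ w < b
        w<b = ≤∧≢⇒< (∈-windowTo⁻ K≤b+1 w∈) (w≢v ∘ toℕ-injective)
        w+1<b : suc (toℕ w) < b
        w+1<b = subst (suc (toℕ w) <_) (sym v≡u+1)
                  (s≤s (≤∧≢⇒< (≤-pred (subst (toℕ w <_) v≡u+1 w<b)) (w≢u ∘ toℕ-injective)))

    H-chord : ∀ {u v} → toℕ u ≡ 0 → toℕ v ≡ suc K → adj H u v ≡ true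
    H-chord {u} {v} u≡0 v≡K+1 with toℕ-injective {i = u} {j = zero} u≡0
    ... | refl = sole-neighbour (connected-in-H chordSet-connectedSet) zero∈chordSet v∈ u≢v others
      where
      v∈ : v ∈ chordSet
      v∈ = x∈p∪q⁺ (inj₁ (∈-interval⁺ (suc K) (suc k) (≤-reflexive (sym v≡K+1))
                                       (subst (_< suc K + suc k) (sym v≡K+1) (m<m+n (suc K) z<s))))
      u≢v : zero ≢ v
      u≢v refl = contradiction v≡K+1 λ ()
      others : ∀ {w} → w ∈ chordSet → w ≢ zero → w ≢ v → adj H zero w ≡ false
      others {w} w∈ w≢0 w≢v with x∈p∪q⁻ _ _ w∈
      ... | inj₂ w∈0 = contradiction (x∈⁅y⁆⇒x≡y zero w∈0) w≢0
      ... | inj₁ w∈I = nonadjacent-far (≤-trans (s≤s (s≤s z≤n)) K+1<w) (λ _ → inj₂ K+1<w)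
        where
        K+1<w : suc K < toℕ w
        K+1<w = ≤∧≢⇒< (proj₁ (∈-interval⁻ (suc K) (suc k) w∈I))
                      (λ e → w≢v (toℕ-injective (trans (sym e) (sym v≡K+1))))

    H-¬shortcut : ∀ {u v} → toℕ u ≡ 0 → toℕ v ≡ K → adj H u v ≡ false
    H-¬shortcut {u} {v} u≡0 v≡K with adj H u v in e
    ... | false = refl
    ... | true with toℕ-injective {i = u} {j = zero} u≡0
    ... | refl with neighbour-in (proj₂ S-connected) v∈S 0∈S v≢0
      where
      I S : Subset order
      I = interval 0 (suc k) order
      S = I ∪ ⁅ v ⁆
      0∈I : zero ∈ I
      0∈I = ∈-interval⁺ 0 (suc k) z≤n z<s
      v∉I : v ∉ I
      v∉I v∈I = <⇒≱ (proj₂ (∈-interval⁻ 0 (suc k) v∈I)) (≤-trans (n≤1+n _) (≤-reflexive (sym v≡K)))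
      S-connected : ConnectedSet K lollipop S
      S-connected = proj₂ (same S)
        ( trans (∣p∪⁅x⁆∣≡1+∣p∣ I v∉I) (cong suc (∣interval∣ 0 (suc k) order (≤-trans (n≤1+n _) K≤order)))
        , ∪⁅⁆-connected (interval-connected H-path 0 (suc k)) 0∈I e )
      v∈S : v ∈ S
      v∈S = x∈p∪q⁺ (inj₂ (x∈⁅x⁆ v))
      0∈S : zero ∈ S
      0∈S = x∈p∪q⁺ (inj₁ 0∈I)
      v≢0 : v ≢ zero
      v≢0 refl = contradiction v≡K λ ()
    ... | w , w∈S , e′ with x∈p∪q⁻ _ _ w∈S
    ...   | inj₁ w∈I = contradiction (edge-sym (L.adj⁻ e′))
                         (¬edge-far w+1<v λ _ K≡K+1 → 1+n≢n (sym (trans (sym v≡K) K≡K+1)))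
      where
      w+1<v : suc (toℕ w) < toℕ v
      w+1<v = subst (suc (toℕ w) <_) (sym v≡K) (s≤s (proj₂ (∈-interval⁻ 0 (suc k) w∈I)))
    ...   | inj₂ w∈v with x∈⁅y⁆⇒x≡y v w∈v
    ...     | refl = contradiction (trans (sym e′) (Graph.irrefl lollipop w)) λ ()

    H-edge : ∀ {u v} → toℕ u < toℕ v → Edge (toℕ u) (toℕ v) → adj H u v ≡ true
    H-edge         _   (inj₁ (inj₁ v≡u+1))         = H-path v≡u+1
    H-edge {v = v} u<v (inj₁ (inj₂ u≡v+1))         =
      contradiction (subst (toℕ v ≤_) (sym u≡v+1) (n≤1+n _)) (<⇒≱ u<v)
    H-edge         _   (inj₂ (inj₁ (u≡0 , v≡K+1))) = H-chord u≡0 v≡K+1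
    H-edge         u<v (inj₂ (inj₂ (_ , v≡0)))     = contradiction (subst (_ <_) v≡0 u<v) λ ()

    H-¬edge : ∀ {u v} → toℕ u < toℕ v → ¬ Edge (toℕ u) (toℕ v) → adj H u v ≡ false
    H-¬edge {u} {v} u<v ¬edge with toℕ u ≟ 0 | toℕ v ≟ K
    ... | yes u≡0 | yes v≡K = H-¬shortcut u≡0 v≡K
    ... | yes u≡0 | no v≢K  = nonadjacent-far (¬edge∧<⇒1+< u<v ¬edge) λ _ →
      m≢n∧m≢1+n⇒m<n⊎1+n<m v≢K λ v≡K+1 → ¬edge (inj₂ (inj₁ (u≡0 , v≡K+1)))
    ... | no u≢0  | _       = nonadjacent-far (¬edge∧<⇒1+< u<v ¬edge) λ u≡0 → contradiction u≡0 u≢0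

    agree-< : ∀ {u v} → toℕ u < toℕ v → adj lollipop u v ≡ adj H u v
    agree-< {u} {v} u<v with edge? (toℕ u) (toℕ v)
    ... | yes edge = trans (L.adj⁺ edge) (sym (H-edge u<v edge))
    ... | no ¬edge = trans (L.adj-false ¬edge) (sym (H-¬edge u<v ¬edge))

    lollipop≡H : SameGraph lollipop H
    lollipop≡H u v with <-cmp (toℕ u) (toℕ v)
    ... | tri< u<v _ _ = agree-< u<v
    ... | tri> _ _ v<u = trans (Graph.sym lollipop u v) (trans (agree-< v<u) (Graph.sym H v u))
    ... | tri≈ _ u≡v _ with toℕ-injective u≡v
    ...   | refl = trans (Graph.irrefl lollipop u) (sym (Graph.irrefl H u))

  determined : DeterminedBy K lollipop
  determined H _ same = Determined.lollipop≡H H same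

  Edge⁺ : Rel ℕ 0ℓ
  Edge⁺ = Edge Union.∪ Chord K

  module L⁺ = FromRelation (Union.decidable edge? (chord? K))
                           (Union.symmetric {L = Edge} {R = Chord K} edge-sym chord-sym)
                           (Union.irreflexive _≡_ Edge (Chord K) edge-irrefl chord-irrefl) order

  lollipop⁺ : Graph order
  lollipop⁺ = L⁺.graph

  lollipop⊆lollipop⁺ : ∀ {S u w} → u ∈ S → w ∈ S → adj lollipop u w ≡ true → WalkIn lollipop⁺ S u w
  lollipop⊆lollipop⁺ {u = u} {w} u∈S w∈S e = step u∈S (L⁺.adj⁺ (inj₁ (L.adj⁻ {u} {w} e))) (stay w∈S)

  ≤K-closed : ∀ {a b} → Edge⁺ a b → a ≤ K → b ≢ suc K → b ≤ K
  ≤K-closed (inj₁ (inj₁ (inj₁ refl)))        a≤K b≢K+1 = ≤∧≢⇒< a≤K (b≢K+1 ∘ cong suc)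
  ≤K-closed (inj₁ (inj₁ (inj₂ refl)))        a≤K _     = ≤-trans (n≤1+n _) a≤K
  ≤K-closed (inj₁ (inj₂ (inj₁ (_ , b≡K+1)))) _   b≢K+1 = contradiction b≡K+1 b≢K+1
  ≤K-closed (inj₁ (inj₂ (inj₂ (_ , refl))))  _   _     = z≤n
  ≤K-closed (inj₂ (inj₁ (_ , refl)))         _   _     = ≤-refl
  ≤K-closed (inj₂ (inj₂ (_ , refl)))         _   _     = z≤n

  initial-segment⊆ : ∀ {S} → ∣ S ∣ ≡ suc K → InducedConnected lollipop⁺ S → zero ∈ S → junction ∉ S →
                     interval 0 (suc K) order ⊆ S
  initial-segment⊆ {S} ∣S∣≡ conn 0∈S junction∉S =
    p⊆q∧∣q∣≤∣p∣⇒q⊆p S (interval 0 (suc K) order) S⊆I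
      (≤-reflexive (trans (∣interval∣ 0 (suc K) order (<⇒≤ K+1<order)) (sym ∣S∣≡)))
    where
    closed : ∀ {u w} → w ∈ S → adj lollipop⁺ u w ≡ true → toℕ u ≤ K → toℕ w ≤ K
    closed w∈S e u≤K = ≤K-closed (L⁺.adj⁻ e) u≤K λ w≡K+1 →
      junction∉S (subst (_∈ S) (toℕ-injective (trans w≡K+1 (sym (toℕ-fromℕ< K+1<order)))) w∈S)
    S⊆I : S ⊆ interval 0 (suc K) order
    S⊆I {x} x∈S = ∈-interval⁺ 0 (suc K) z≤n
      (s≤s (walk-invariant (λ w → toℕ w ≤ K) closed (conn zero x 0∈S x∈S) z≤n))

  shortcut-bypass : ∀ {S v} → ∣ S ∣ ≡ suc K → InducedConnected lollipop⁺ S → toℕ v ≡ K →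
                    zero ∈ S → v ∈ S → WalkIn lollipop S zero v
  shortcut-bypass {S} {v} ∣S∣≡ conn v≡K 0∈S v∈S with junction ∈? S
  ... | yes junction∈S =
    step 0∈S (L.adj⁺ (inj₂ (inj₁ (refl , toℕ-fromℕ< K+1<order))))
      (step junction∈S (L.adj⁺ (inj₁ (inj₂ (trans (toℕ-fromℕ< K+1<order) (cong suc (sym v≡K))))))
            (stay v∈S))
  ... | no junction∉S = walk-along lollipop-path z≤n λ {w} _ w≤v →
    initial-segment⊆ ∣S∣≡ conn 0∈S junction∉S (∈-interval⁺ 0 (suc K) z≤n (s≤s (subst (toℕ w ≤_) v≡K w≤v)))

  lollipop⁺-edge-bypass : ∀ {S u w} → ∣ S ∣ ≡ suc K → InducedConnected lollipop⁺ S →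
                          u ∈ S → w ∈ S → adj lollipop⁺ u w ≡ true → WalkIn lollipop S u w
  lollipop⁺-edge-bypass {u = u} {w} ∣S∣≡ conn u∈S w∈S e with L⁺.adj⁻ e
  ... | inj₁ edge = step u∈S (L.adj⁺ edge) (stay w∈S)
  ... | inj₂ (inj₁ (u≡0 , w≡K)) with toℕ-injective {i = u} {j = zero} u≡0
  ...   | refl = shortcut-bypass ∣S∣≡ conn w≡K u∈S w∈S
  lollipop⁺-edge-bypass {u = u} {w} ∣S∣≡ conn u∈S w∈S e | inj₂ (inj₂ (u≡K , w≡0))
    with toℕ-injective {i = w} {j = zero} w≡0
  ...   | refl = walk-reverse (shortcut-bypass ∣S∣≡ conn u≡K w∈S u∈S)

  undetermined : NotDeterminedBy (suc K) lollipop
  undetermined = lollipop⁺ , lollipop⁺-connected , lollipop≢lollipop⁺ , same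
    where
    lollipop⁺-connected : Connected lollipop⁺
    lollipop⁺-connected u v u∈ v∈ = walk-map lollipop⊆lollipop⁺ (lollipop-connected u v u∈ v∈)
    K<order : K < order
    K<order = ≤-trans (n≤1+n _) K+1<order
    lollipop≢lollipop⁺ : ¬ SameGraph lollipop lollipop⁺
    lollipop≢lollipop⁺ equal = contradiction
      (trans (sym (L.adj-false ¬edge)) (trans (equal zero (fromℕ< K<order)) (L⁺.adj⁺ shortcut))) λ ()
      where
      shortcut : Edge⁺ 0 (toℕ (fromℕ< K<order))
      shortcut = inj₂ (inj₁ (refl , toℕ-fromℕ< K<order))
      ¬edge : ¬ Edge 0 (toℕ (fromℕ< K<order))
      ¬edge = ¬edge-far (subst (1 <_) (sym (toℕ-fromℕ< K<order)) (s≤s (s≤s z≤n)))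
                        (λ _ K≡K+1 → 1+n≢n (sym (trans (sym (toℕ-fromℕ< K<order)) K≡K+1)))
    same : SameConnectedSets (suc K) lollipop lollipop⁺
    same S = (λ (∣S∣≡ , conn) → ∣S∣≡ , λ u v u∈ v∈ → walk-map lollipop⊆lollipop⁺ (conn u v u∈ v∈))
           , (λ (∣S∣≡ , conn) → ∣S∣≡ , λ u v u∈ v∈ →
                walk-map (lollipop⁺-edge-bypass ∣S∣≡ conn) (conn u v u∈ v∈))

proposition1 : ∀ (k : ℕ) → 2 ≤ k → ∀ (N : ℕ) →
    ∃[ n ] (N ≤ n × Σ (Graph n) (λ G → Connected G × DeterminedBy k G × NotDeterminedBy (suc k) G))
proposition1 (suc (suc k)) (s≤s (s≤s z≤n)) N =
  order , m≤n+m N (2 + K + K) , lollipop , lollipop-connected , determined , undetermined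
  where open Lollipop k N
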